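{- Let $A$ be an alphabet with $q\geq 2$ letters, and for $n\geq 1$ let $M_q(n)=q^{ -n}\sum_{w\in A^n}P(w)$, where $P(w)$ is the number of distinct nonempty palindromes occurring as factors of $w$. Then $$\limsup_{n\to\infty}\frac{M_q(n)}{n}\leq\frac{q+1}{q(q-1)}.$$
   Context: $A^n$ is the set of words of length $n$ over $A$. A word is a palindrome if it equals its reversal; a factor is a block of consecutive letters of a word. -}

module Defs where

open import Data.Nat using (ℕ; zero; suc; _+_; _*_; _^_)
open import Data.Fin using (Fin)
open import Data.Fin.Properties using () renaming (_≟_ to _≟F_)
open import Data.List using (List; []; _∷_; map; concatMap; length; filter; inits; tails; reverse; deduplicate; allFin)
open import Data.List.Properties using (≡-dec)
open import Data.Nat.ListAction using (sum)
open import Data.Integer using (+_)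
open import Data.Rational using (ℚ; 0ℚ; _/_)
open import Relation.Binary.PropositionalEquality using (_≡_)
open import Relation.Nullary using (Dec)

words : (q n : ℕ) → List (List (Fin q))
words q zero = [] ∷ []
words q (suc n) = concatMap (λ a → map (a ∷_) (words q n)) (allFin q)

_≟W_ : ∀ {q} (u v : List (Fin q)) → Dec (u ≡ v)
_≟W_ = ≡-dec _≟F_

nonemptyPrefixes : ∀ {q} → List (Fin q) → List (List (Fin q))
nonemptyPrefixes [] = []
nonemptyPrefixes (x ∷ xs) = map (x ∷_) (inits xs)

factors : ∀ {q} → List (Fin q) → List (List (Fin q))
factors w = concatMap nonemptyPrefixes (tails w)

IsPalindrome : ∀ {q} → List (Fin q) → Set
IsPalindrome w = w ≡ reverse w

isPalindrome? : ∀ {q} (w : List (Fin q)) → Dec (IsPalindrome w)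
isPalindrome? w = w ≟W reverse w

P : ∀ {q} → List (Fin q) → ℕ
P w = length (deduplicate _≟W_ (filter isPalindrome? (factors w)))

S : (q n : ℕ) → ℕ
S q n = sum (map P (words q n))

-- a / b as a rational (b = 0 never occurs where used; then 0)
frac : ℕ → ℕ → ℚ
frac a zero = 0ℚ
frac a (suc b) = (+ a) / suc b

-- M_q(n) / n = S q n / (q^n * n)
Mq/n : (q n : ℕ) → ℚ
Mq/n q n = frac (S q n) (q ^ n * n)

module Submission where

-- Call a palindrome long if its length is at least 3.  A distinct
-- palindromic factor of w is either one of the K words of length ≤ 2, or a long
-- palindrome, which occurs at least once; hence  P w ≤ K + Occ w, where Occ w counts the
-- occurrences (with repetition) of long palindromes in w.  Averaging Occ over A^n is a
-- linear computation: if π k is the number of palindromes in A^k, then π (k+2) = q·π k,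
-- the total number F m of long palindromic prefixes over A^m satisfies
-- F (m+1) = q·F m + π (m+1) (for m ≥ 2), and the total T n of Occ over A^n satisfies
-- T (n+1) = F (n+1) + q·T n.  An exact invariant gives q(q-1)·F m ≤ (q+1)·q^m, hence
-- q(q-1)·T n ≤ n(q+1)·q^n and  M_q(n)/n ≤ K/n + (q+1)/(q(q-1)), which is below the
-- bound + ε once n ≥ K/ε.

open import Defs
open import Data.Nat using (ℕ; zero; suc; _≤_; _<_; _+_; _*_; _∸_; _^_; z≤n; s≤s)
open import Data.Nat.Properties
open import Data.Nat.Tactic.RingSolver using (solve-∀)
open import Data.Nat.ListAction using (sum)
open import Data.Nat.ListAction.Properties using (sum-++)
open import Data.Nat.Coprimality using (Coprime)
-- the embedding ℕ → ℤ is called  pos  here, to keep  +  unambiguous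
open import Data.Integer as ℤ using (-[1+_]; +≤+; +<+) renaming (+_ to pos)
import Data.Integer.Properties as ℤP
open import Data.Rational using (ℚ; mkℚ; 0ℚ; toℚᵘ; *<*) renaming (_≤_ to _≤ℚ_; _<_ to _<ℚ_; _+_ to _+ℚ_)
open import Data.Rational.Properties using (toℚᵘ-cancel-≤; toℚᵘ-fromℚᵘ; toℚᵘ-homo-+)
open import Data.Rational.Unnormalised using (mkℚᵘ; *≤*) renaming (_+_ to _+ᵘ_)
import Data.Rational.Unnormalised.Properties as ℚᵘP
open import Data.Fin using (Fin) renaming (zero to fzero; suc to fsuc)
open import Data.Fin.Properties using () renaming (_≟_ to _≟F_)
open import Data.List using (List; []; _∷_; _++_; map; concatMap; length; filter; reverse; allFin; inits; deduplicate)
open import Data.List.Properties using (map-++; map-∘; map-tabulate; length-tabulate; length-++; unfold-reverse; reverse-++; ∷-injective; ∷ʳ-injectiveˡ; filter-notAll)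
open import Data.List.Membership.Propositional using (_∈_)
open import Data.List.Membership.Propositional.Properties using (∈-filter⁺; ∈-deduplicate⁻; ∈-map⁺; ∈-++⁺ˡ; ∈-++⁺ʳ; ∈-concat⁺′; ∈-allFin)
open import Data.List.Relation.Unary.Any as Any using (here; there)
import Data.List.Relation.Unary.All as All
open import Data.List.Relation.Unary.AllPairs using (_∷_)
open import Data.List.Relation.Unary.Unique.Propositional using (Unique)
open import Data.List.Relation.Unary.Unique.DecPropositional.Properties using (deduplicate-!)
open import Data.Product using (∃-syntax; _×_; _,_; proj₁; proj₂)
open import Data.Bool using (if_then_else_)
open import Data.Empty using (⊥-elim)
open import Relation.Binary.Definitions using (DecidableEquality)
open import Relation.Binary.PropositionalEquality
open import Relation.Nullary using (Dec; yes; no; does; ¬_; ¬?)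
open import Function using (_∘_; id)

ind : ∀ {ℓ} {A : Set ℓ} → Dec A → ℕ
ind d = if does d then 1 else 0

ind-yes : ∀ {ℓ} {A : Set ℓ} (d : Dec A) → A → ind d ≡ 1
ind-yes (yes _) _ = refl
ind-yes (no ¬a) a = ⊥-elim (¬a a)

ind-no : ∀ {ℓ} {A : Set ℓ} (d : Dec A) → ¬ A → ind d ≡ 0
ind-no (yes a) ¬a = ⊥-elim (¬a a)
ind-no (no _) _ = refl

module _ {A : Set} where

  sum-cong : ∀ (xs : List A) {f g : A → ℕ} → (∀ x → f x ≡ g x) → sum (map f xs) ≡ sum (map g xs)
  sum-cong [] _ = refl
  sum-cong (x ∷ xs) f≗g = cong₂ _+_ (f≗g x) (sum-cong xs f≗g)

  sum-mono : ∀ (xs : List A) {f g : A → ℕ} → (∀ x → f x ≤ g x) → sum (map f xs) ≤ sum (map g xs)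
  sum-mono [] _ = z≤n
  sum-mono (x ∷ xs) f≤g = +-mono-≤ (f≤g x) (sum-mono xs f≤g)

  sum-+ : ∀ (xs : List A) (f g : A → ℕ) → sum (map (λ x → f x + g x) xs) ≡ sum (map f xs) + sum (map g xs)
  sum-+ [] f g = refl
  sum-+ (x ∷ xs) f g = trans (cong (f x + g x +_) (sum-+ xs f g)) (interchange (f x) (g x) _ _)
    where
      interchange : ∀ a b c d → (a + b) + (c + d) ≡ (a + c) + (b + d)
      interchange = solve-∀

  sum-* : ∀ (xs : List A) (c : ℕ) (f : A → ℕ) → sum (map (λ x → c * f x) xs) ≡ c * sum (map f xs)
  sum-* [] c f = sym (*-zeroʳ c)
  sum-* (x ∷ xs) c f = trans (cong (c * f x +_) (sum-* xs c f)) (sym (*-distribˡ-+ c (f x) _))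

  sum-const : ∀ (xs : List A) (c : ℕ) → sum (map (λ _ → c) xs) ≡ length xs * c
  sum-const [] c = refl
  sum-const (x ∷ xs) c = cong (c +_) (sum-const xs c)

sum-concatMap : ∀ {A B : Set} (h : A → List B) (f : B → ℕ) (xs : List A) →
  sum (map f (concatMap h xs)) ≡ sum (map (λ x → sum (map f (h x))) xs)
sum-concatMap h f [] = refl
sum-concatMap h f (x ∷ xs) = begin
    sum (map f (h x ++ concatMap h xs))             ≡⟨ cong sum (map-++ f (h x) _) ⟩
    sum (map f (h x) ++ map f (concatMap h xs))     ≡⟨ sum-++ (map f (h x)) _ ⟩
    sum (map f (h x)) + sum (map f (concatMap h xs)) ≡⟨ cong (sum (map f (h x)) +_) (sum-concatMap h f xs) ⟩
    sum (map f (h x)) + sum (map (λ y → sum (map f (h y))) xs) ∎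
  where open ≡-Reasoning

sum-allFin-suc : ∀ n (f : Fin (suc n) → ℕ) → sum (map f (allFin (suc n))) ≡ f fzero + sum (map (f ∘ fsuc) (allFin n))
sum-allFin-suc n f = cong (λ xs → f fzero + sum xs) (trans (map-tabulate fsuc f) (sym (map-tabulate id (f ∘ fsuc))))

sum-equal-letter : ∀ n (a : Fin n) → sum (map (λ b → ind (a ≟F b)) (allFin n)) ≡ 1
sum-equal-letter (suc n) fzero = trans (sum-allFin-suc n (λ b → ind (fzero ≟F b))) (cong suc (trans (sum-const (allFin n) 0) (*-zeroʳ (length (allFin n)))))
sum-equal-letter (suc n) (fsuc a) = trans (sum-allFin-suc n (λ b → ind (fsuc a ≟F b))) (sum-equal-letter n a)

module Words (q : ℕ) where

  Word : Set
  Word = List (Fin q)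

  ΣA : (Fin q → ℕ) → ℕ
  ΣA g = sum (map g (allFin q))

  ΣW : ℕ → (Word → ℕ) → ℕ
  ΣW n f = sum (map f (words q n))

  ΣA-const : ∀ c → ΣA (λ _ → c) ≡ q * c
  ΣA-const c = trans (sum-const (allFin q) c) (cong (_* c) (length-tabulate {n = q} id))

  ΣW-cons : ∀ n f → ΣW (suc n) f ≡ ΣA (λ a → ΣW n (λ v → f (a ∷ v)))
  ΣW-cons n f = trans (sum-concatMap (λ a → map (a ∷_) (words q n)) f (allFin q))
                      (sum-cong (allFin q) (λ a → cong sum (sym (map-∘ (words q n)))))

  ΣW-snoc : ∀ n f → ΣW (suc n) f ≡ ΣW n (λ u → ΣA (λ b → f (u ++ b ∷ [])))
  ΣW-snoc zero f = trans (ΣW-cons zero f) (trans (sum-cong (allFin q) (λ a → +-identityʳ (f (a ∷ [])))) (sym (+-identityʳ _)))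
  ΣW-snoc (suc n) f = begin
      ΣW (suc (suc n)) f                                      ≡⟨ ΣW-cons (suc n) f ⟩
      ΣA (λ a → ΣW (suc n) (λ v → f (a ∷ v)))                 ≡⟨ sum-cong (allFin q) (λ a → ΣW-snoc n (λ v → f (a ∷ v))) ⟩
      ΣA (λ a → ΣW n (λ u → ΣA (λ b → f (a ∷ u ++ b ∷ [])))) ≡⟨ sym (ΣW-cons n _) ⟩
      ΣW (suc n) (λ u → ΣA (λ b → f (u ++ b ∷ [])))           ∎
    where open ≡-Reasoning

  ΣW-cong : ∀ n {f g} → (∀ w → length w ≡ n → f w ≡ g w) → ΣW n f ≡ ΣW n g
  ΣW-cong zero f≗g = cong (_+ 0) (f≗g [] refl)
  ΣW-cong (suc n) {f} {g} f≗g = begin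
      ΣW (suc n) f                      ≡⟨ ΣW-cons n f ⟩
      ΣA (λ a → ΣW n (λ v → f (a ∷ v))) ≡⟨ sum-cong (allFin q) (λ a → ΣW-cong n (λ v e → f≗g (a ∷ v) (cong suc e))) ⟩
      ΣA (λ a → ΣW n (λ v → g (a ∷ v))) ≡⟨ sym (ΣW-cons n g) ⟩
      ΣW (suc n) g                      ∎
    where open ≡-Reasoning

  ΣW-const : ∀ n c → ΣW n (λ _ → c) ≡ q ^ n * c
  ΣW-const zero c = refl
  ΣW-const (suc n) c = begin
      ΣW (suc n) (λ _ → c)      ≡⟨ ΣW-cons n (λ _ → c) ⟩
      ΣA (λ _ → ΣW n (λ _ → c)) ≡⟨ cong (λ s → ΣA (λ _ → s)) (ΣW-const n c) ⟩
      ΣA (λ _ → q ^ n * c)      ≡⟨ ΣA-const _ ⟩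
      q * (q ^ n * c)           ≡⟨ sym (*-assoc q (q ^ n) c) ⟩
      q ^ suc n * c             ∎
    where open ≡-Reasoning

module Palindromes (q : ℕ) where
  open Words q

  palInd : Word → ℕ
  palInd w = ind (isPalindrome? w)

  reverse-bracket : ∀ (a : Fin q) u b → reverse (a ∷ u ++ b ∷ []) ≡ b ∷ (reverse u ++ a ∷ [])
  reverse-bracket a u b = trans (unfold-reverse a (u ++ b ∷ [])) (cong (_++ a ∷ []) (reverse-++ u (b ∷ [])))

  palindrome-outer : ∀ (a : Fin q) u b → IsPalindrome (a ∷ u ++ b ∷ []) → a ≡ b × IsPalindrome u
  palindrome-outer a u b pal =
    let a≡b , u≡ = ∷-injective (trans pal (reverse-bracket a u b))
    in a≡b , ∷ʳ-injectiveˡ u (reverse u) u≡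

  palindrome-wrap : ∀ (a : Fin q) u → IsPalindrome u → IsPalindrome (a ∷ u ++ a ∷ [])
  palindrome-wrap a u pal = trans (cong (λ v → a ∷ v ++ a ∷ []) pal) (sym (reverse-bracket a u a))

  palInd-bracket : ∀ (a : Fin q) u b → palInd (a ∷ u ++ b ∷ []) ≡ ind (a ≟F b) * palInd u
  palInd-bracket a u b with a ≟F b | isPalindrome? u
  ... | yes refl | yes pal = ind-yes (isPalindrome? _) (palindrome-wrap a u pal)
  ... | yes _    | no ¬pal = ind-no (isPalindrome? _) (¬pal ∘ proj₂ ∘ palindrome-outer a u b)
  ... | no a≢b   | _       = ind-no (isPalindrome? _) (a≢b ∘ proj₁ ∘ palindrome-outer a u b)

  π : ℕ → ℕ
  π k = ΣW k palInd

  -- a palindrome of length k+2 is a u a with a ∈ A and u a palindrome of length k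
  π-step : ∀ k → π (suc (suc k)) ≡ q * π k
  π-step k = begin
      ΣW (suc (suc k)) palInd                                   ≡⟨ ΣW-cons (suc k) palInd ⟩
      ΣA (λ a → ΣW (suc k) (λ v → palInd (a ∷ v)))              ≡⟨ sum-cong (allFin q) (λ a → ΣW-snoc k (λ v → palInd (a ∷ v))) ⟩
      ΣA (λ a → ΣW k (λ u → ΣA (λ b → palInd (a ∷ u ++ b ∷ [])))) ≡⟨ sum-cong (allFin q) (λ a → sum-cong (words q k) (outer-letters a)) ⟩
      ΣA (λ _ → π k)                                            ≡⟨ ΣA-const (π k) ⟩
      q * π k                                                   ∎
    where
      open ≡-Reasoning
      outer-letters : ∀ a u → ΣA (λ b → palInd (a ∷ u ++ b ∷ [])) ≡ palInd u
      outer-letters a u = begin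
        ΣA (λ b → palInd (a ∷ u ++ b ∷ []))  ≡⟨ sum-cong (allFin q) (λ b → trans (palInd-bracket a u b) (*-comm _ (palInd u))) ⟩
        ΣA (λ b → palInd u * ind (a ≟F b))   ≡⟨ sum-* (allFin q) (palInd u) _ ⟩
        palInd u * ΣA (λ b → ind (a ≟F b))   ≡⟨ cong (palInd u *_) (sum-equal-letter q a) ⟩
        palInd u * 1                         ≡⟨ *-identityʳ _ ⟩
        palInd u                             ∎

  π-one : π 1 ≡ q
  π-one = begin
      ΣW 1 palInd                 ≡⟨ ΣW-cons 0 palInd ⟩
      ΣA (λ a → palInd (a ∷ []) + 0) ≡⟨ sum-cong (allFin q) (λ a → cong (_+ 0) (ind-yes (isPalindrome? (a ∷ [])) refl)) ⟩
      ΣA (λ _ → 1)                ≡⟨ ΣA-const 1 ⟩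
      q * 1                       ≡⟨ *-identityʳ q ⟩
      q                           ∎
    where open ≡-Reasoning

-- Decision of 3 ≤ n by cases, so that it computes on 0, 1, 2 and 3 + k.
three≤? : ∀ n → Dec (3 ≤ n)
three≤? 0 = no λ ()
three≤? 1 = no λ { (s≤s ()) }
three≤? 2 = no λ { (s≤s (s≤s ())) }
three≤? (suc (suc (suc n))) = yes (s≤s (s≤s (s≤s z≤n)))

module Occurrences (q : ℕ) where
  open Words q
  open Palindromes q

  long? : (w : Word) → Dec (3 ≤ length w)
  long? w = three≤? (length w)

  χ : Word → ℕ
  χ w = ind (long? w) * palInd w

  PO : Word → ℕ
  PO w = sum (map χ (nonemptyPrefixes w))

  Occ : Word → ℕ
  Occ w = sum (map χ (factors w))

  F T Pal : ℕ → ℕ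
  F m = ΣW m PO
  T n = ΣW n Occ
  Pal k = ΣW k χ

  length-long-palindromes : ∀ (xs : List Word) → length (filter long? (filter isPalindrome? xs)) ≡ sum (map χ xs)
  length-long-palindromes [] = refl
  length-long-palindromes (x ∷ xs) with isPalindrome? x
  ... | no _ = trans (length-long-palindromes xs) (cong (_+ sum (map χ xs)) (sym (*-zeroʳ (ind (long? x)))))
  ... | yes _ with long? x
  ...   | yes _ = cong suc (length-long-palindromes xs)
  ...   | no _  = length-long-palindromes xs

  Pal-formula : ∀ k → Pal k ≡ ind (three≤? k) * π k
  Pal-formula k = trans (ΣW-cong k {g = λ w → ind (three≤? k) * palInd w} (λ w len≡k → cong (λ m → ind (three≤? m) * palInd w) len≡k))
                        (sum-* (words q k) (ind (three≤? k)) palInd)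

  Pal-short : ∀ k → k ≤ 2 → Pal k ≡ 0
  Pal-short k k≤2 = trans (Pal-formula k) (cong (_* π k) (ind-no (three≤? k) (≤⇒≯ k≤2)))

  Pal-long : ∀ k → Pal (3 + k) ≡ π (3 + k)
  Pal-long k = trans (Pal-formula (3 + k)) (+-identityʳ _)

  inits-snoc : ∀ (u : Word) b → inits (u ++ b ∷ []) ≡ inits u ++ (u ++ b ∷ []) ∷ []
  inits-snoc [] b = refl
  inits-snoc (x ∷ u) b = cong ([] ∷_) (trans (cong (map (x ∷_)) (inits-snoc u b)) (map-++ (x ∷_) (inits u) _))

  PO-snoc : ∀ u b → PO (u ++ b ∷ []) ≡ PO u + χ (u ++ b ∷ [])
  PO-snoc [] b = refl
  PO-snoc (x ∷ u) b = begin
      sum (map χ (map (x ∷_) (inits (u ++ b ∷ []))))                       ≡⟨ cong (λ ps → sum (map χ (map (x ∷_) ps))) (inits-snoc u b) ⟩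
      sum (map χ (map (x ∷_) (inits u ++ (u ++ b ∷ []) ∷ [])))             ≡⟨ cong (sum ∘ map χ) (map-++ (x ∷_) (inits u) _) ⟩
      sum (map χ (nonemptyPrefixes (x ∷ u) ++ (x ∷ u ++ b ∷ []) ∷ []))     ≡⟨ cong sum (map-++ χ (nonemptyPrefixes (x ∷ u)) _) ⟩
      sum (map χ (nonemptyPrefixes (x ∷ u)) ++ χ (x ∷ u ++ b ∷ []) ∷ [])   ≡⟨ sum-++ (map χ (nonemptyPrefixes (x ∷ u))) _ ⟩
      PO (x ∷ u) + (χ (x ∷ u ++ b ∷ []) + 0)                               ≡⟨ cong (PO (x ∷ u) +_) (+-identityʳ _) ⟩
      PO (x ∷ u) + χ (x ∷ u ++ b ∷ [])                                     ∎
    where open ≡-Reasoning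

  Occ-cons : ∀ a w → Occ (a ∷ w) ≡ PO (a ∷ w) + Occ w
  Occ-cons a w = trans (cong sum (map-++ χ (nonemptyPrefixes (a ∷ w)) (factors w))) (sum-++ (map χ (nonemptyPrefixes (a ∷ w))) _)

  -- Extending by a last letter b: every prefix of u is kept (q times), and u b is new.
  F-step : ∀ m → F (suc m) ≡ q * F m + Pal (suc m)
  F-step m = begin
      ΣW (suc m) PO                                                  ≡⟨ ΣW-snoc m PO ⟩
      ΣW m (λ u → ΣA (λ b → PO (u ++ b ∷ [])))                       ≡⟨ sum-cong (words q m) last-letter ⟩
      ΣW m (λ u → q * PO u + ΣA (λ b → χ (u ++ b ∷ [])))             ≡⟨ sum-+ (words q m) _ _ ⟩
      ΣW m (λ u → q * PO u) + ΣW m (λ u → ΣA (λ b → χ (u ++ b ∷ []))) ≡⟨ cong₂ _+_ (sum-* (words q m) q PO) (sym (ΣW-snoc m χ)) ⟩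
      q * F m + Pal (suc m)                                          ∎
    where
      open ≡-Reasoning
      last-letter : ∀ u → ΣA (λ b → PO (u ++ b ∷ [])) ≡ q * PO u + ΣA (λ b → χ (u ++ b ∷ []))
      last-letter u = trans (sum-cong (allFin q) (PO-snoc u))
                            (trans (sum-+ (allFin q) (λ _ → PO u) (λ b → χ (u ++ b ∷ []))) (cong (_+ ΣA (λ b → χ (u ++ b ∷ []))) (ΣA-const (PO u))))

  -- Extending by a first letter a: the new factors are the prefixes of a v.
  T-step : ∀ n → T (suc n) ≡ F (suc n) + q * T n
  T-step n = begin
      ΣW (suc n) Occ                                             ≡⟨ ΣW-cons n Occ ⟩
      ΣA (λ a → ΣW n (λ v → Occ (a ∷ v)))                        ≡⟨ sum-cong (allFin q) first-letter ⟩
      ΣA (λ a → ΣW n (λ v → PO (a ∷ v)) + T n)                   ≡⟨ sum-+ (allFin q) _ _ ⟩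
      ΣA (λ a → ΣW n (λ v → PO (a ∷ v))) + ΣA (λ _ → T n)        ≡⟨ cong₂ _+_ (sym (ΣW-cons n PO)) (ΣA-const (T n)) ⟩
      F (suc n) + q * T n                                        ∎
    where
      open ≡-Reasoning
      first-letter : ∀ a → ΣW n (λ v → Occ (a ∷ v)) ≡ ΣW n (λ v → PO (a ∷ v)) + T n
      first-letter a = trans (sum-cong (words q n) (Occ-cons a)) (sum-+ (words q n) (λ v → PO (a ∷ v)) Occ)

module _ {A : Set} (_≟_ : DecidableEquality A) where

  unique-length-≤ : ∀ (xs ys : List A) → Unique xs → (∀ {z} → z ∈ xs → z ∈ ys) → length xs ≤ length ys
  unique-length-≤ [] ys _ _ = z≤n
  unique-length-≤ (x ∷ xs) ys (x∉xs ∷ xs-unique) xs⊆ys = begin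
      suc (length xs)                             ≤⟨ s≤s (unique-length-≤ xs ys-x xs-unique xs⊆ys-x) ⟩
      suc (length ys-x)                           ≤⟨ filter-notAll (¬? ∘ (x ≟_)) ys (Any.map (λ x≡y x≢y → x≢y x≡y) (xs⊆ys (here refl))) ⟩
      length ys                                   ∎
    where
      open ≤-Reasoning
      ys-x : List A
      ys-x = filter (¬? ∘ (x ≟_)) ys
      xs⊆ys-x : ∀ {z} → z ∈ xs → z ∈ ys-x
      xs⊆ys-x z∈xs = ∈-filter⁺ (¬? ∘ (x ≟_)) (xs⊆ys (there z∈xs)) (All.lookup x∉xs z∈xs)

-- Every distinct palindromic factor is either one of the K words of length ≤ 2,
-- or accounts for at least one occurrence of a palindrome of length ≥ 3:  P w ≤ K + Occ w.
module DistinctPalindromes (q : ℕ) where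
  open Words q
  open Palindromes q
  open Occurrences q

  words-complete : ∀ n (w : Word) → length w ≡ n → w ∈ words q n
  words-complete zero [] refl = here refl
  words-complete (suc n) (a ∷ w) len≡ =
    ∈-concat⁺′ (∈-map⁺ (a ∷_) (words-complete n w (suc-injective len≡))) (∈-map⁺ (λ b → map (b ∷_) (words q n)) (∈-allFin a))

  shortWords : List Word
  shortWords = words q 0 ++ words q 1 ++ words q 2

  K : ℕ
  K = length shortWords

  short∈shortWords : ∀ (w : Word) → ¬ (3 ≤ length w) → w ∈ shortWords
  short∈shortWords [] _ = ∈-++⁺ˡ (words-complete 0 [] refl)
  short∈shortWords (a ∷ []) _ = ∈-++⁺ʳ (words q 0) (∈-++⁺ˡ (words-complete 1 (a ∷ []) refl))
  short∈shortWords (a ∷ b ∷ []) _ = ∈-++⁺ʳ (words q 0) (∈-++⁺ʳ (words q 1) (words-complete 2 (a ∷ b ∷ []) refl))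
  short∈shortWords (a ∷ b ∷ c ∷ w) short = ⊥-elim (short (s≤s (s≤s (s≤s z≤n))))

  P-bound : ∀ (w : Word) → P w ≤ K + Occ w
  P-bound w = begin
      length (deduplicate _≟W_ pals)                 ≤⟨ unique-length-≤ _≟W_ _ _ (deduplicate-! _≟W_ pals) (classify ∘ ∈-deduplicate⁻ _≟W_ pals) ⟩
      length (shortWords ++ filter long? pals)       ≡⟨ length-++ shortWords ⟩
      K + length (filter long? pals)                 ≡⟨ cong (K +_) (length-long-palindromes (factors w)) ⟩
      K + Occ w                                      ∎
    where
      open ≤-Reasoning
      pals : List Word
      pals = filter isPalindrome? (factors w)
      classify : ∀ {z} → z ∈ pals → z ∈ shortWords ++ filter long? pals
      classify {z} z∈pals with long? z
      ... | yes long = ∈-++⁺ʳ shortWords (∈-filter⁺ long? z∈pals long)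
      ... | no short = ∈-++⁺ˡ (short∈shortWords z short)

-- The quantity
--   X m = q p F m + q π (m+1) + π (m+2)
-- is multiplied by q at each step m ≥ 2 (by F-step and π-step), and X 2 = (q+1) q²,
-- whence q p F m ≤ (q+1) q^m; then T-step sums this bound over the n starting positions.
module Bounds (p : ℕ) where

  q : ℕ
  q = suc p

  open Words q
  open Palindromes q
  open Occurrences q
  open DistinctPalindromes q

  -- no word of length ≤ 2 has a long palindromic prefix
  F-short : ∀ m → m ≤ 2 → F m ≡ 0
  F-short zero _ = refl
  F-short (suc m) m<2 = begin
      F (suc m)              ≡⟨ F-step m ⟩
      q * F m + Pal (suc m)  ≡⟨ cong₂ (λ f c → q * f + c) (F-short m (<⇒≤ m<2)) (Pal-short (suc m) m<2) ⟩
      q * 0 + 0              ≡⟨ cong (_+ 0) (*-zeroʳ q) ⟩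
      0                      ∎
    where open ≡-Reasoning

  F-invariant : ∀ k → q * p * F (2 + k) + q * π (3 + k) + π (4 + k) ≡ (q + 1) * q ^ (2 + k)
  F-invariant zero = begin
      q * p * F 2 + q * π 3 + π 4         ≡⟨ cong (λ f → q * p * f + q * π 3 + π 4) (F-short 2 ≤-refl) ⟩
      q * p * 0 + q * π 3 + π 4           ≡⟨ cong₂ (λ a b → q * p * 0 + q * a + b) (trans (π-step 1) (cong (q *_) π-one)) (π-step 2) ⟩
      q * p * 0 + q * (q * q) + q * π 2   ≡⟨ cong (λ b → q * p * 0 + q * (q * q) + q * b) (π-step 0) ⟩
      q * p * 0 + q * (q * q) + q * (q * 1) ≡⟨ initial p ⟩
      (q + 1) * q ^ 2                     ∎
    where
      open ≡-Reasoning
      initial : ∀ p → let q = suc p in q * p * 0 + q * (q * q) + q * (q * 1) ≡ (q + 1) * (q * (q * 1))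
      initial = solve-∀
  F-invariant (suc k) = begin
      q * p * F (3 + k) + q * π (4 + k) + π (5 + k)
        ≡⟨ cong₂ (λ f c → q * p * f + q * π (4 + k) + c) (trans (F-step (2 + k)) (cong (q * F (2 + k) +_) (Pal-long k))) (π-step (3 + k)) ⟩
      q * p * (q * F (2 + k) + π (3 + k)) + q * π (4 + k) + q * π (3 + k)
        ≡⟨ regroup p (F (2 + k)) (π (3 + k)) (π (4 + k)) ⟩
      q * (q * p * F (2 + k) + q * π (3 + k) + π (4 + k))
        ≡⟨ cong (q *_) (F-invariant k) ⟩
      q * ((q + 1) * q ^ (2 + k))
        ≡⟨ x*[y*z]≡y*[x*z] q (q + 1) (q ^ (2 + k)) ⟩
      (q + 1) * q ^ (3 + k) ∎
    where
      open ≡-Reasoning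
      regroup : ∀ p f a b → let q = suc p in
        q * p * (q * f + a) + q * b + q * a ≡ q * (q * p * f + q * a + b)
      regroup = solve-∀
      x*[y*z]≡y*[x*z] : ∀ x y z → x * (y * z) ≡ y * (x * z)
      x*[y*z]≡y*[x*z] = solve-∀

  F-bound-short : ∀ m → m ≤ 2 → q * p * F m ≤ (q + 1) * q ^ m
  F-bound-short m m≤2 = ≤-trans (≤-reflexive (trans (cong (q * p *_) (F-short m m≤2)) (*-zeroʳ (q * p)))) z≤n

  F-bound : ∀ m → q * p * F m ≤ (q + 1) * q ^ m
  F-bound 0 = F-bound-short 0 z≤n
  F-bound 1 = F-bound-short 1 (s≤s z≤n)
  F-bound (suc (suc k)) = ≤-trans (≤-trans (m≤m+n _ _) (m≤m+n _ _)) (≤-reflexive (F-invariant k))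

  T-bound : ∀ n → q * p * T n ≤ n * ((q + 1) * q ^ n)
  T-bound zero = ≤-reflexive (*-zeroʳ (q * p))
  T-bound (suc n) = begin
      q * p * T (suc n)                                     ≡⟨ cong (q * p *_) (T-step n) ⟩
      q * p * (F (suc n) + q * T n)                         ≡⟨ distribute q p (F (suc n)) (T n) ⟩
      q * p * F (suc n) + q * (q * p * T n)                 ≤⟨ +-mono-≤ (F-bound (suc n)) (*-monoʳ-≤ q (T-bound n)) ⟩
      (q + 1) * (q * q ^ n) + q * (n * ((q + 1) * q ^ n))   ≡⟨ collect q n (q ^ n) ⟩
      suc n * ((q + 1) * q ^ suc n)                         ∎
    where
      open ≤-Reasoning
      distribute : ∀ q p f t → q * p * (f + q * t) ≡ q * p * f + q * (q * p * t)
      distribute = solve-∀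
      collect : ∀ q n x → (q + 1) * (q * x) + q * (n * ((q + 1) * x)) ≡ suc n * ((q + 1) * (q * x))
      collect = solve-∀

  S-bound : ∀ n → q * p * S q n ≤ q * p * (q ^ n * K) + n * ((q + 1) * q ^ n)
  S-bound n = begin
      q * p * ΣW n P                     ≤⟨ *-monoʳ-≤ (q * p) (sum-mono (words q n) P-bound) ⟩
      q * p * ΣW n (λ w → K + Occ w)     ≡⟨ cong (q * p *_) (trans (sum-+ (words q n) (λ _ → K) Occ) (cong (_+ T n) (ΣW-const n K))) ⟩
      q * p * (q ^ n * K + T n)          ≡⟨ *-distribˡ-+ (q * p) (q ^ n * K) (T n) ⟩
      q * p * (q ^ n * K) + q * p * T n  ≤⟨ +-monoʳ-≤ (q * p * (q ^ n * K)) (T-bound n) ⟩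
      q * p * (q ^ n * K) + n * ((q + 1) * q ^ n) ∎
    where open ≤-Reasoning

frac≤frac+ : ∀ a D c e k d .(coprime : Coprime (suc k) (suc d)) → 0 < D →
  a * (suc e * suc d) ≤ (c * suc d + suc k * suc e) * D →
  frac a D ≤ℚ frac c (suc e) +ℚ mkℚ (pos (suc k)) d coprime
frac≤frac+ a (suc b) c e k d coprime _ cross = toℚᵘ-cancel-≤ (begin
    toℚᵘ (frac a (suc b))                    ≃⟨ toℚᵘ-fromℚᵘ (mkℚᵘ (pos a) b) ⟩
    mkℚᵘ (pos a) b                           ≤⟨ *≤* integral-cross ⟩
    mkℚᵘ (pos c) e +ᵘ mkℚᵘ (pos (suc k)) d   ≃⟨ ℚᵘP.≃-sym (ℚᵘP.+-congˡ (mkℚᵘ (pos (suc k)) d) (toℚᵘ-fromℚᵘ (mkℚᵘ (pos c) e))) ⟩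
    toℚᵘ (frac c (suc e)) +ᵘ toℚᵘ ε          ≃⟨ ℚᵘP.≃-sym (toℚᵘ-homo-+ (frac c (suc e)) ε) ⟩
    toℚᵘ (frac c (suc e) +ℚ ε)               ∎)
  where
    open ℚᵘP.≤-Reasoning
    ε : ℚ
    ε = mkℚ (pos (suc k)) d coprime
    integral-cross : pos a ℤ.* pos (suc e * suc d) ℤ.≤ (pos c ℤ.* pos (suc d) ℤ.+ pos (suc k) ℤ.* pos (suc e)) ℤ.* pos (suc b)
    integral-cross = ℤP.≤-trans (ℤP.≤-reflexive (sym (ℤP.pos-* a _))) (ℤP.≤-trans (+≤+ cross) (ℤP.≤-reflexive integral-form))
      where
        integral-form : pos ((c * suc d + suc k * suc e) * suc b) ≡ (pos c ℤ.* pos (suc d) ℤ.+ pos (suc k) ℤ.* pos (suc e)) ℤ.* pos (suc b)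
        integral-form = trans (ℤP.pos-* (c * suc d + suc k * suc e) (suc b))
          (cong (ℤ._* pos (suc b)) (trans (ℤP.pos-+ (c * suc d) _) (cong₂ ℤ._+_ (ℤP.pos-* c (suc d)) (ℤP.pos-* (suc k) (suc e)))))

-- Clearing denominators: from  X·S ≤ X·(Q·K) + n·(A·Q)  and  K·s ≤ n  we get
--   S·(X·s) ≤ (A·s + (k+1)·X)·(Q·n),   i.e.  S/(Q·n) ≤ A/X + (k+1)/s.
cleared-bound : ∀ S X K Q n A s k → X * S ≤ X * (Q * K) + n * (A * Q) → K * s ≤ n →
  S * (X * s) ≤ (A * s + suc k * X) * (Q * n)
cleared-bound S X K Q n A s k average large = begin
    S * (X * s)                               ≡⟨ reassociate S X s ⟩
    (X * S) * s                               ≤⟨ *-monoˡ-≤ s average ⟩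
    (X * (Q * K) + n * (A * Q)) * s           ≡⟨ expand X Q K n A s ⟩
    X * Q * (K * s) + A * s * (Q * n)         ≤⟨ +-monoˡ-≤ (A * s * (Q * n)) (*-monoʳ-≤ (X * Q) large) ⟩
    X * Q * n + A * s * (Q * n)               ≤⟨ +-monoˡ-≤ (A * s * (Q * n)) (≤-trans (≤-reflexive (*-assoc X Q n)) (m≤m+n _ (k * (X * (Q * n))))) ⟩
    suc k * (X * (Q * n)) + A * s * (Q * n)   ≡⟨ collect k X Q n A s ⟩
    (A * s + suc k * X) * (Q * n)             ∎
  where
    open ≤-Reasoning
    reassociate : ∀ S X s → S * (X * s) ≡ (X * S) * s
    reassociate = solve-∀
    expand : ∀ X Q K n A s → (X * (Q * K) + n * (A * Q)) * s ≡ X * Q * (K * s) + A * s * (Q * n)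
    expand = solve-∀
    collect : ∀ k X Q n A s → suc k * (X * (Q * n)) + A * s * (Q * n) ≡ (A * s + suc k * X) * (Q * n)
    collect = solve-∀

mainTheorem7 : (q : ℕ) → 2 ≤ q → (ε : ℚ) → 0ℚ <ℚ ε →
    ∃[ N ] ((n : ℕ) → N ≤ n → Mq/n q n ≤ℚ (frac (q + 1) (q * (q ∸ 1)) +ℚ ε))
-- With ε = (k+1)/(d+1), the bound holds from N = K (d+1) + 1 on; the remaining clauses
-- dismiss q < 2 and ε ≤ 0.
mainTheorem7 (suc (suc p)) (s≤s (s≤s _)) (mkℚ (pos (suc k)) d coprime) _ = suc (K * suc d) , eventually
  where
    open Bounds (suc p)
    open DistinctPalindromes q using (K)
    eventually : ∀ n → suc (K * suc d) ≤ n → Mq/n q n ≤ℚ (frac (q + 1) (q * suc p) +ℚ mkℚ (pos (suc k)) d coprime)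
    eventually n N≤n = frac≤frac+ (S q n) (q ^ n * n) (q + 1) _ k d coprime
      (*-mono-≤ (m^n>0 q n) (≤-trans (s≤s z≤n) N≤n))
      (cleared-bound (S q n) (q * suc p) K (q ^ n) n (q + 1) (suc d) k (S-bound n) (≤-trans (n≤1+n _) N≤n))
mainTheorem7 (suc zero) (s≤s ()) _ _
mainTheorem7 q _ (mkℚ (pos zero) _ _) (*<* (+<+ ()))
mainTheorem7 q _ (mkℚ -[1+ _ ] _ _) (*<* ())
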